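{- Let $\Gamma$ be a simple connected graph with vertex set $\{v_1,\dots,v_n\}$, and let $V=(x_1,\dots,x_n)$ be a vector in the row space over $\mathbb{R}$ of the adjacency matrix $A(\Gamma)$ (with respect to the order $v_1,\dots,v_n$), where each $x_i\in\{0,1\}$. Then for any vector $m=(m_1,\dots,m_n)$ of positive integers, the vector $$V'=(\underbrace{x_1,\dots,x_1}_{m_1},\underbrace{x_2,\dots,x_2}_{m_2},\dots,\underbrace{x_n,\dots,x_n}_{m_n})$$ lies in the row space over $\mathbb{R}$ of the adjacency matrix $A(\Gamma\odot m)$, where the vertices of $\Gamma\odot m$ are ordered $v_1^1,\dots,v_1^{m_1},v_2^1,\dots,v_2^{m_2},\dots,v_n^1,\dots,v_n^{m_n}$.
   Context: The adjacency matrix $A(\Gamma)=(a_{ij})$ has $a_{ij}=1$ if $v_i$ is adjacent to $v_j$ and $0$ otherwise. Multiplication of vertices: for a graph $\Gamma$ with vertices $v_1,\dots,v_n$ and a vector $m=(m_1,\dots,m_n)$ of positive integers, $\Gamma\odot m$ is the graph obtained by replacing each $v_i$ by an independent set of $m_i$ vertices $v_i^1,\dots,v_i^{m_i}$, with $v_i^s$ adjacent to $v_j^t$ if and only if $v_i$ and $v_j$ are adjacent in $\Gamma$.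
   Formalization: Both row spaces, of $A(\Gamma)$ and of $A(\Gamma\odot m)$, are taken over ℚ rather than ℝ. -}

module Defs where

open import Data.Nat using (ℕ; zero; suc; _≥_) renaming (_+_ to _+ℕ_)
open import Data.Fin using (Fin; zero; suc; splitAt)
open import Data.Bool using (Bool; true; false; if_then_else_)
open import Data.Sum using (_⊎_; inj₁; inj₂)
open import Data.Product using (Σ; ∃; _×_)
open import Data.Rational using (ℚ; 0ℚ; 1ℚ; _+_; _*_)
open import Relation.Binary.PropositionalEquality using (_≡_)

Graph : ℕ → Set
Graph n = Fin n → Fin n → Bool

IsSimple : ∀ {n} → Graph n → Set
IsSimple {n} G = (∀ (i j : Fin n) → G i j ≡ G j i) × (∀ (i : Fin n) → G i i ≡ false)

data Walk {n : ℕ} (G : Graph n) : Fin n → Fin n → Set where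
  here : ∀ {i} → Walk G i i
  step : ∀ {i j k} → G i j ≡ true → Walk G j k → Walk G i k

IsConnected : ∀ {n} → Graph n → Set
IsConnected {n} G = ∀ (i j : Fin n) → Walk G i j

adjMatrix : ∀ {n} → Graph n → Fin n → Fin n → ℚ
adjMatrix G i j = if G i j then 1ℚ else 0ℚ

∑ : ∀ n → (Fin n → ℚ) → ℚ
∑ zero    f = 0ℚ
∑ (suc n) f = f zero + ∑ n (λ i → f (suc i))

InRowSpace : ∀ {r c} → (Fin r → Fin c → ℚ) → (Fin c → ℚ) → Set
InRowSpace {r} {c} M x = Σ (Fin r → ℚ) λ λs → ∀ (j : Fin c) → ∑ r (λ i → λs i * M i j) ≡ x j

total : ∀ n → (Fin n → ℕ) → ℕ
total zero    m = 0
total (suc n) m = m zero +ℕ total n (λ i → m (suc i))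

-- In the ordering v_1^1,…,v_1^{m_1},v_2^1,…,v_n^{m_n}, the vertex with
-- position k lies in block (block n m k), i.e. is a copy of v_{block k}.
block : ∀ n (m : Fin n → ℕ) → Fin (total n m) → Fin n
block zero    m ()
block (suc n) m k with splitAt (m zero) k
... | inj₁ _  = zero
... | inj₂ k' = suc (block n (λ i → m (suc i)) k')

_⊙_ : ∀ {n} → Graph n → (m : Fin n → ℕ) → Graph (total n m)
_⊙_ {n} G m k l = G (block n m k) (block n m l)

blowVec : ∀ {n} (m : Fin n → ℕ) → (Fin n → ℚ) → Fin (total n m) → ℚ
blowVec {n} m x k = x (block n m k)

{-# OPTIONS --safe #-}
module Submission where

-- Row k of A(Γ ⊙ m) is row (block k) of A(Γ) with each column repeated, so the
-- rows of the blow-up span the blown-up row space of A(Γ): if V = Σ λᵢ Aᵢ, put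
-- λᵢ on one copy of vᵢ (there is one since mᵢ ≥ 1) and 0 on all other copies.

open import Defs
open import Data.Nat using (ℕ; zero; suc; _≥_; s≤s) renaming (_+_ to _+ℕ_)
open import Data.Fin using (Fin; zero; suc; splitAt; _↑ˡ_; _↑ʳ_)
open import Data.Fin.Properties using (splitAt-↑ˡ; splitAt-↑ʳ)
open import Data.Sum using (_⊎_; [_,_]′)
open import Data.Product using (_,_)
open import Data.Rational using (ℚ; 0ℚ; 1ℚ; _+_; _*_)
open import Data.Rational.Properties using (+-identityˡ; +-identityʳ; +-assoc; *-zeroˡ)
open import Function using (_∘_)
open import Relation.Binary.PropositionalEquality

∑-cong : ∀ n {f g : Fin n → ℚ} → (∀ i → f i ≡ g i) → ∑ n f ≡ ∑ n g
∑-cong zero    f≗g = refl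
∑-cong (suc n) f≗g = cong₂ _+_ (f≗g zero) (∑-cong n (f≗g ∘ suc))

∑-zero : ∀ n {f : Fin n → ℚ} → (∀ i → f i ≡ 0ℚ) → ∑ n f ≡ 0ℚ
∑-zero zero    f≗0 = refl
∑-zero (suc n) {f} f≗0 = begin
  f zero + ∑ n (f ∘ suc)  ≡⟨ cong₂ _+_ (f≗0 zero) (∑-zero n (f≗0 ∘ suc)) ⟩
  0ℚ + 0ℚ                 ≡⟨ +-identityˡ 0ℚ ⟩
  0ℚ                      ∎
  where open ≡-Reasoning

∑-splitAt : ∀ a b (f : Fin (a +ℕ b) → ℚ) →
  ∑ (a +ℕ b) f ≡ ∑ a (f ∘ (_↑ˡ b)) + ∑ b (f ∘ (a ↑ʳ_))
∑-splitAt zero    b f = sym (+-identityˡ _)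
∑-splitAt (suc a) b f = begin
  f zero + ∑ (a +ℕ b) (f ∘ suc)                                 ≡⟨ cong (f zero +_) (∑-splitAt a b (f ∘ suc)) ⟩
  f zero + (∑ a (f ∘ suc ∘ (_↑ˡ b)) + ∑ b (f ∘ suc ∘ (a ↑ʳ_)))  ≡⟨ sym (+-assoc (f zero) _ _) ⟩
  (f zero + ∑ a (f ∘ suc ∘ (_↑ˡ b))) + ∑ b (f ∘ suc ∘ (a ↑ʳ_))  ∎
  where open ≡-Reasoning

onFirst : ∀ {a} → ℚ → Fin a → ℚ
onFirst q zero    = q
onFirst q (suc _) = 0ℚ

∑-onFirst : ∀ a → a ≥ 1 → (q c : ℚ) → ∑ a (λ j → onFirst q j * c) ≡ q * c
∑-onFirst (suc a) (s≤s _) q c = begin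
  q * c + ∑ a (λ _ → 0ℚ * c)  ≡⟨ cong (q * c +_) (∑-zero a (λ _ → *-zeroˡ c)) ⟩
  q * c + 0ℚ                  ≡⟨ +-identityʳ (q * c) ⟩
  q * c                       ∎
  where open ≡-Reasoning

firstCopies : ∀ {n} (m : Fin n → ℕ) → (Fin n → ℚ) → Fin (total n m) → ℚ
firstCopies {zero}  m λs ()
firstCopies {suc n} m λs k =
  [ onFirst (λs zero) , firstCopies (m ∘ suc) (λs ∘ suc) ]′ (splitAt (m zero) k)

module _ {n} (m : Fin (suc n) → ℕ) where

  private
    T = total n (m ∘ suc)

  block-↑ˡ : ∀ j → block (suc n) m (j ↑ˡ T) ≡ zero
  block-↑ˡ j rewrite splitAt-↑ˡ (m zero) j T = refl

  block-↑ʳ : ∀ k → block (suc n) m (m zero ↑ʳ k) ≡ suc (block n (m ∘ suc) k)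
  block-↑ʳ k rewrite splitAt-↑ʳ (m zero) T k = refl

  firstCopies-↑ˡ : ∀ λs j → firstCopies m λs (j ↑ˡ T) ≡ onFirst (λs zero) j
  firstCopies-↑ˡ λs j = cong [ _ , _ ]′ (splitAt-↑ˡ (m zero) j T)

  firstCopies-↑ʳ : ∀ λs k → firstCopies m λs (m zero ↑ʳ k) ≡ firstCopies (m ∘ suc) (λs ∘ suc) k
  firstCopies-↑ʳ λs k = cong [ _ , _ ]′ (splitAt-↑ʳ (m zero) T k)

∑-firstCopies : ∀ n (m : Fin n → ℕ) → (∀ i → m i ≥ 1) → (λs h : Fin n → ℚ) →
  ∑ (total n m) (λ k → firstCopies m λs k * h (block n m k)) ≡ ∑ n (λ i → λs i * h i)
∑-firstCopies zero    m m≥1 λs h = refl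
∑-firstCopies (suc n) m m≥1 λs h = begin
  ∑ (m zero +ℕ T) term                                     ≡⟨ ∑-splitAt (m zero) T term ⟩
  ∑ (m zero) (term ∘ (_↑ˡ T)) + ∑ T (term ∘ (m zero ↑ʳ_))  ≡⟨ cong₂ _+_ firstBlock otherBlocks ⟩
  λs zero * h zero + ∑ n (λ i → λs (suc i) * h (suc i))    ∎
  where
  open ≡-Reasoning
  T = total n (m ∘ suc)
  term = λ k → firstCopies m λs k * h (block (suc n) m k)

  firstBlock : ∑ (m zero) (term ∘ (_↑ˡ T)) ≡ λs zero * h zero
  firstBlock = trans
    (∑-cong (m zero) λ j → cong₂ _*_ (firstCopies-↑ˡ m λs j) (cong h (block-↑ˡ m j)))
    (∑-onFirst (m zero) (m≥1 zero) (λs zero) (h zero))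

  otherBlocks : ∑ T (term ∘ (m zero ↑ʳ_)) ≡ ∑ n (λ i → λs (suc i) * h (suc i))
  otherBlocks = trans
    (∑-cong T λ k → cong₂ _*_ (firstCopies-↑ʳ m λs k) (cong h (block-↑ʳ m k)))
    (∑-firstCopies n (m ∘ suc) (m≥1 ∘ suc) (λs ∘ suc) (h ∘ suc))

InRowSpace-blowRows : ∀ {n c} (m : Fin n → ℕ) → (∀ i → m i ≥ 1) →
  (M : Fin n → Fin c → ℚ) (x : Fin c → ℚ) →
  InRowSpace M x → InRowSpace (M ∘ block n m) x
InRowSpace-blowRows {n} m m≥1 M x (λs , λsM≡x) =
  firstCopies m λs , λ j → trans (∑-firstCopies n m m≥1 λs (λ i → M i j)) (λsM≡x j)

InRowSpace-reindexColumns : ∀ {r c c′} (f : Fin c′ → Fin c) (M : Fin r → Fin c → ℚ) (x : Fin c → ℚ) →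
  InRowSpace M x → InRowSpace (λ i j → M i (f j)) (x ∘ f)
InRowSpace-reindexColumns f M x (λs , λsM≡x) = λs , λsM≡x ∘ f

lemma2p10 : ∀ (n : ℕ) (G : Graph n) → IsSimple G → IsConnected G →
    (x : Fin n → ℚ) → (∀ i → x i ≡ 0ℚ ⊎ x i ≡ 1ℚ) →
    InRowSpace (adjMatrix G) x →
    (m : Fin n → ℕ) → (∀ i → m i ≥ 1) →
    InRowSpace (adjMatrix (G ⊙ m)) (blowVec m x)
lemma2p10 n G _ _ x _ x∈rowA m m≥1 =
  InRowSpace-reindexColumns (block n m) (adjMatrix G ∘ block n m) x
    (InRowSpace-blowRows m m≥1 (adjMatrix G) x x∈rowA)
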